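{- There is an absolute constant $C>0$ such that for all positive integers $\delta,\Delta$ with $\Delta\leq\delta^2\leq\Delta^2$, there exists a graph $G$ with minimum degree $\delta$ and maximum degree $\Delta$ such that every spanning $C_4$-free subgraph $H$ of $G$ satisfies $\delta(H)\leq C\,\frac{\delta}{\sqrt{\Delta}}$.
   Context: All graphs are finite and simple; $C_4$ is the cycle of length 4; $\delta(H)$ is the minimum degree of $H$; a spanning subgraph of $G$ has the same vertex set as $G$. -}

module Defs where

open import Data.Nat using (ℕ; _≤_; _≥_)
open import Data.Fin using (Fin)
open import Data.Bool using (Bool; true; false)
open import Data.List using (length; filterᵇ; allFin)
open import Data.Product using (Σ; ∃; _×_)
open import Relation.Binary.PropositionalEquality using (_≡_; _≢_)
open import Relation.Nullary using (¬_)

record Graph (n : ℕ) : Set where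
  field
    adj    : Fin n → Fin n → Bool
    sym    : ∀ u v → adj u v ≡ adj v u
    irrefl : ∀ v → adj v v ≡ false
open Graph public

deg : ∀ {n} → Graph n → Fin n → ℕ
deg {n} G v = length (filterᵇ (adj G v) (allFin n))

IsMinDegree : ∀ {n} → Graph n → ℕ → Set
IsMinDegree G d = (∀ v → d ≤ deg G v) × ∃ λ v → deg G v ≡ d

IsMaxDegree : ∀ {n} → Graph n → ℕ → Set
IsMaxDegree G D = (∀ v → deg G v ≤ D) × ∃ λ v → deg G v ≡ D

IsSpanningSubgraph : ∀ {n} → Graph n → Graph n → Set
IsSpanningSubgraph H G = ∀ u v → adj H u v ≡ true → adj G u v ≡ true

-- G contains a (not necessarily induced) 4-cycle a-b-c-d-a on four distinct
-- vertices. (a≠b, b≠c, c≠d, d≠a follow from irreflexivity.)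
HasC4 : ∀ {n} → Graph n → Set
HasC4 {n} G = Σ (Fin n) λ a → Σ (Fin n) λ b → Σ (Fin n) λ c → Σ (Fin n) λ d →
  a ≢ c × b ≢ d ×
  adj G a b ≡ true × adj G b c ≡ true × adj G c d ≡ true × adj G d a ≡ true

C4Free : ∀ {n} → Graph n → Set
C4Free G = ¬ HasC4 G

-- Take G = K_{δ,Δ}, the complete bipartite graph with parts A (δ vertices,
-- each of degree Δ) and B (Δ vertices, each of degree δ); δ ≤ Δ follows from
-- δ² ≤ Δ², so G has minimum degree δ and maximum degree Δ.  Let H ⊆ G be a
-- spanning C₄-free subgraph of minimum degree d.  Double count the "cherries"
-- a – b – a' of H with centre b ∈ B and a ≠ a' (ordered):
--   * a centre b of H-degree x carries x² − x ≥ d² − d cherries, so there are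
--     at least Δ(d² − d) of them;
--   * the ends a, a' lie in A, and two distinct vertices of a C₄-free graph
--     have at most one common neighbour, so there are at most δ² of them.
-- Hence Δd² ≤ δ² + Δd, which together with Δ ≤ δ² gives d²Δ ≤ 2²δ².
module Submission where

open import Defs hiding (sym)
open import Data.Nat using (ℕ; zero; suc; _+_; _*_; _≤_; z≤n; s≤s; _≤?_; _<ᵇ_)
open import Data.Nat.Properties hiding (_≟_; suc-injective)
open import Data.Nat.Solver using (module +-*-Solver)
open import Data.Bool using (Bool; true; false; not; _∧_; _xor_; if_then_else_)
open import Data.Bool.Properties using (∧-conicalˡ; ∧-conicalʳ; xor-comm; xor-same)
open import Data.Fin using (Fin; zero; suc; toℕ; _↑ʳ_)
open import Data.Fin.Properties using (_≟_; toℕ-↑ʳ; suc-injective)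
open import Data.List using (length; filterᵇ; tabulate)
open import Data.Product using (Σ; _×_; _,_)
open import Relation.Binary.PropositionalEquality
open import Relation.Nullary using (does; yes; no; contradiction)
open import Relation.Nullary.Decidable using (decidable-stable)
open import Algebra.Properties.Semiring.Sum +-*-semiring
  using (sum; sum-syntax; sum-cong-≗; sum-replicate-zero; ∑-comm; ∑-distrib-+; *-distribˡ-sum; *-distribʳ-sum)

open +-*-Solver

𝟙 : Bool → ℕ
𝟙 true  = 1
𝟙 false = 0

𝟙-∧ : ∀ x y → 𝟙 (x ∧ y) ≡ 𝟙 x * 𝟙 y
𝟙-∧ true  y = sym (+-identityʳ (𝟙 y))
𝟙-∧ false y = refl

𝟙-idem : ∀ x → 𝟙 x * 𝟙 x ≡ 𝟙 x
𝟙-idem true  = refl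
𝟙-idem false = refl

𝟙-∧-≤ʳ : ∀ x y → 𝟙 (x ∧ y) ≤ 𝟙 y
𝟙-∧-≤ʳ true  y = ≤-refl
𝟙-∧-≤ʳ false y = z≤n

𝟙≢ : ∀ {n} → Fin n → Fin n → ℕ
𝟙≢ i j = 𝟙 (not (does (i ≟ j)))

count : ∀ {n} → (Fin n → Bool) → ℕ
count {n} p = ∑[ i < n ] 𝟙 (p i)

sum-mono : ∀ {n} {f g : Fin n → ℕ} → (∀ i → f i ≤ g i) → sum f ≤ sum g
sum-mono {zero}  f≤g = z≤n
sum-mono {suc n} f≤g = +-mono-≤ (f≤g zero) (sum-mono (λ i → f≤g (suc i)))

sum-pull : ∀ {n} (f : Fin n → ℕ) i → sum f ≡ f i + ∑[ j < n ] (𝟙≢ i j * f j)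
sum-pull {suc n} f zero = cong (f zero +_) (sum-cong-≗ (λ j → sym (+-identityʳ (f (suc j)))))
sum-pull {suc n} f (suc i) = begin
  f zero + sum (λ j → f (suc j))
    ≡⟨ cong (f zero +_) (sum-pull (λ j → f (suc j)) i) ⟩
  f zero + (f (suc i) + rest)
    ≡⟨ solve 3 (λ a b c → a :+ (b :+ c) := b :+ (a :+ con 0 :+ c)) refl (f zero) (f (suc i)) rest ⟩
  f (suc i) + (f zero + 0 + rest) ∎
  where
  open ≡-Reasoning
  rest = ∑[ j < n ] (𝟙≢ i j * f (suc j))

count-none : ∀ {n} (p : Fin n → Bool) → (∀ i → p i ≡ false) → count p ≡ 0
count-none {n} p none = trans (sum-cong-≗ (λ i → cong 𝟙 (none i))) (sum-replicate-zero n)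

count-unique : ∀ {n} (p : Fin n → Bool) → (∀ i j → p i ≡ true → p j ≡ true → i ≡ j) → count p ≤ 1
count-unique {zero}  p uniq = z≤n
count-unique {suc n} p uniq with p zero in p₀
... | false = count-unique (λ i → p (suc i)) (λ i j pi pj → suc-injective (uniq (suc i) (suc j) pi pj))
... | true  = ≤-reflexive (cong suc (count-none (λ i → p (suc i)) only-zero))
  where
  only-zero : ∀ i → p (suc i) ≡ false
  only-zero i with p (suc i) in pᵢ
  ... | false = refl
  ... | true with uniq zero (suc i) p₀ pᵢ
  ... | ()

count-within : ∀ {n} (p : Fin n → Bool) c → (∀ i → p i ≡ true → c ≡ true) → count p ≤ 1 → count p ≤ 𝟙 c
count-within p true  forces ≤1 = ≤1
count-within p false forces ≤1 = ≤-reflexive (count-none p none)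
  where
  none : ∀ i → p i ≡ false
  none i with p i in pᵢ
  ... | false = refl
  ... | true with forces i pᵢ
  ... | ()

count-filter : ∀ {A : Set} {n} (f : Fin n → A) (p : A → Bool) → length (filterᵇ p (tabulate f)) ≡ count (λ i → p (f i))
count-filter {n = zero}  f p = refl
count-filter {n = suc n} f p with p (f zero)
... | true  = cong suc (count-filter (λ i → f (suc i)) p)
... | false = count-filter (λ i → f (suc i)) p

count-square : ∀ {n} (x : Fin n → Bool) →
  count x * count x ≡ count x + ∑[ i < n ] ∑[ j < n ] (𝟙 (x i ∧ x j) * 𝟙≢ i j)
count-square {n} x = begin
  count x * count x                                         ≡⟨ *-distribʳ-sum (count x) (λ i → 𝟙 (x i)) ⟩
  ∑[ i < n ] (𝟙 (x i) * count x)                            ≡⟨ sum-cong-≗ row ⟩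
  ∑[ i < n ] (𝟙 (x i) + ∑[ j < n ] (𝟙 (x i ∧ x j) * 𝟙≢ i j)) ≡⟨ ∑-distrib-+ (λ i → 𝟙 (x i)) _ ⟩
  count x + ∑[ i < n ] ∑[ j < n ] (𝟙 (x i ∧ x j) * 𝟙≢ i j)    ∎
  where
  open ≡-Reasoning
  pair : ∀ i j → 𝟙 (x i) * (𝟙≢ i j * 𝟙 (x j)) ≡ 𝟙 (x i ∧ x j) * 𝟙≢ i j
  pair i j rewrite 𝟙-∧ (x i) (x j) =
    solve 3 (λ a b c → a :* (c :* b) := a :* b :* c) refl (𝟙 (x i)) (𝟙 (x j)) (𝟙≢ i j)
  row : ∀ i → 𝟙 (x i) * count x ≡ 𝟙 (x i) + ∑[ j < n ] (𝟙 (x i ∧ x j) * 𝟙≢ i j)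
  row i = begin
    𝟙 (x i) * count x
      ≡⟨ cong (𝟙 (x i) *_) (sum-pull (λ j → 𝟙 (x j)) i) ⟩
    𝟙 (x i) * (𝟙 (x i) + ∑[ j < n ] (𝟙≢ i j * 𝟙 (x j)))
      ≡⟨ *-distribˡ-+ (𝟙 (x i)) _ _ ⟩
    𝟙 (x i) * 𝟙 (x i) + 𝟙 (x i) * ∑[ j < n ] (𝟙≢ i j * 𝟙 (x j))
      ≡⟨ cong₂ _+_ (𝟙-idem (x i)) (*-distribˡ-sum (𝟙 (x i)) (λ j → 𝟙≢ i j * 𝟙 (x j))) ⟩
    𝟙 (x i) + ∑[ j < n ] (𝟙 (x i) * (𝟙≢ i j * 𝟙 (x j)))
      ≡⟨ cong (𝟙 (x i) +_) (sum-cong-≗ (pair i)) ⟩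
    𝟙 (x i) + ∑[ j < n ] (𝟙 (x i ∧ x j) * 𝟙≢ i j) ∎

degree-count : ∀ {n} (G : Graph n) v → deg G v ≡ count (adj G v)
degree-count G v = count-filter (λ u → u) (adj G v)

cherries : ∀ {n} → Graph n → Fin n → ℕ
cherries {n} H b = ∑[ a < n ] ∑[ a' < n ] (𝟙 (adj H b a ∧ adj H b a') * 𝟙≢ a a')

-- x ↦ x² − x is monotone: d ≤ x implies d² + x ≤ x² + d.
square-minus-mono : ∀ d x → d ≤ x → d * d + x ≤ x * x + d
square-minus-mono d x d≤x with m≤n⇒∃[o]m+o≡n d≤x
... | k , refl = begin
  d * d + (d + k)               ≡⟨ +-assoc (d * d) d k ⟨
  d * d + d + k                 ≤⟨ +-monoʳ-≤ (d * d + d) (≤-trans (n≤n*n k) (m≤n+m (k * k) (2 * d * k))) ⟩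
  d * d + d + (2 * d * k + k * k) ≡⟨ expand d k ⟩
  (d + k) * (d + k) + d         ∎
  where
  open ≤-Reasoning
  n≤n*n : ∀ n → n ≤ n * n
  n≤n*n zero      = z≤n
  n≤n*n n@(suc _) = m≤m*n n n
  expand : ∀ d k → d * d + d + (2 * d * k + k * k) ≡ (d + k) * (d + k) + d
  expand = solve 2 (λ d k → d :* d :+ d :+ (con 2 :* d :* k :+ k :* k) := (d :+ k) :* (d :+ k) :+ d) refl

cherries-lower : ∀ {n} (H : Graph n) b d → d ≤ deg H b → d * d ≤ cherries H b + d
cherries-lower H b d d≤deg = +-cancelˡ-≤ x (d * d) (cherries H b + d) (begin
  x + d * d                 ≡⟨ +-comm x (d * d) ⟩
  d * d + x                 ≤⟨ square-minus-mono d x (subst (d ≤_) (degree-count H b) d≤deg) ⟩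
  x * x + d                 ≡⟨ cong (_+ d) (count-square (adj H b)) ⟩
  x + cherries H b + d      ≡⟨ +-assoc x (cherries H b) d ⟩
  x + (cherries H b + d)    ∎)
  where
  open ≤-Reasoning
  x = count (adj H b)

common-neighbour-unique : ∀ {n} (H : Graph n) → C4Free H → ∀ {a a' b b'} → a ≢ a' →
  adj H b a ≡ true → adj H b a' ≡ true → adj H b' a ≡ true → adj H b' a' ≡ true → b ≡ b'
common-neighbour-unique H c4free {a} {a'} {b} {b'} a≢a' ba ba' b'a b'a' =
  decidable-stable (b ≟ b') λ b≢b' →
    c4free (a , b , a' , b' , a≢a' , b≢b' , trans (Graph.sym H a b) ba , ba' , trans (Graph.sym H a' b') b'a' , b'a)

codegree≤1 : ∀ {n} (H : Graph n) → C4Free H → ∀ {a a'} → a ≢ a' → count (λ b → adj H b a ∧ adj H b a') ≤ 1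
codegree≤1 H c4free a≢a' = count-unique _ λ b b' e e' →
  common-neighbour-unique H c4free a≢a' (∧-conicalˡ _ _ e) (∧-conicalʳ _ _ e) (∧-conicalˡ _ _ e') (∧-conicalʳ _ _ e')

-- The complete bipartite graph K m k

-- Vertices of K m k are Fin (m + k); the first m form the part A, the
-- remaining k the part B.
inA inB : ∀ m {k} → Fin (m + k) → Bool
inA m u = toℕ u <ᵇ m
inB m u = not (inA m u)

K : ∀ m k → Graph (m + k)
K m k = record
  { adj    = λ u v → inA m u xor inA m v
  ; sym    = λ u v → xor-comm (inA m u) (inA m v)
  ; irrefl = λ v → xor-same (inA m v)
  }

count-all : ∀ n → count {n} (λ _ → true) ≡ n
count-all zero    = refl
count-all (suc n) = cong suc (count-all n)

count-A : ∀ m k → count (inA m {k}) ≡ m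
count-A zero    k = count-none (inA 0 {k}) (λ _ → refl)
count-A (suc m) k = cong suc (count-A m k)

count-B : ∀ m k → count (inB m {k}) ≡ k
count-B zero    k = count-all k
count-B (suc m) k = count-B m k

deg-K : ∀ m k u → deg (K m k) u ≡ (if inA m u then k else m)
deg-K m k u rewrite degree-count (K m k) u with inA m u
... | true  = count-B m k
... | false = count-A m k

K-edge-B→A : ∀ m k {u v} → adj (K m k) u v ≡ true → inB m u ≡ true → inA m v ≡ true
K-edge-B→A m k {u} e uB with inA m u
... | false = e

first-B-vertex : ∀ m k → inA m {suc k} (m ↑ʳ zero) ≡ false
first-B-vertex m k = trans (cong (_<ᵇ m) (toℕ-↑ʳ m zero)) (not-below m)
  where
  not-below : ∀ m → ((m + 0) <ᵇ m) ≡ false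
  not-below zero    = refl
  not-below (suc m) = not-below m

K-minDegree : ∀ m k → 1 ≤ k → m ≤ k → IsMinDegree (K m k) m
K-minDegree m (suc k) _ m≤k = at-least , m ↑ʳ zero , witness
  where
  at-least : ∀ v → m ≤ deg (K m (suc k)) v
  at-least v rewrite deg-K m (suc k) v with inA m v
  ... | true  = m≤k
  ... | false = ≤-refl
  witness : deg (K m (suc k)) (m ↑ʳ zero) ≡ m
  witness = trans (deg-K m (suc k) _) (cong (if_then suc k else m) (first-B-vertex m k))

K-maxDegree : ∀ m k → 1 ≤ m → m ≤ k → IsMaxDegree (K m k) k
K-maxDegree (suc m) k _ m≤k = at-most , zero , deg-K (suc m) k zero
  where
  at-most : ∀ v → deg (K (suc m) k) v ≤ k
  at-most v rewrite deg-K (suc m) k v with inA (suc m) v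
  ... | true  = ≤-refl
  ... | false = m≤k

-- Double counting cherries centred in B

module CherryCount (δ Δ : ℕ) (H : Graph (δ + Δ)) (H⊆K : IsSpanningSubgraph H (K δ Δ)) (c4free : C4Free H) where

  private
    n = δ + Δ

  common-B : Fin n → Fin n → Fin n → Bool
  common-B a a' b = inB δ b ∧ (adj H b a ∧ adj H b a')

  -- Cherries with ends a ≠ a' and centre in B: at most one (C₄-freeness),
  -- and none unless both ends lie in A (H-edges leaving B end in A).
  pair-bound : ∀ a a' → count (common-B a a') * 𝟙≢ a a' ≤ 𝟙 (inA δ a ∧ inA δ a')
  pair-bound a a' with a ≟ a'
  ... | yes _    rewrite *-zeroʳ (count (common-B a a')) = z≤n
  ... | no a≢a' rewrite *-identityʳ (count (common-B a a')) =
    count-within (common-B a a') (inA δ a ∧ inA δ a') ends-in-A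
      (≤-trans (sum-mono (λ b → 𝟙-∧-≤ʳ (inB δ b) _)) (codegree≤1 H c4free a≢a'))
    where
    ends-in-A : ∀ b → common-B a a' b ≡ true → inA δ a ∧ inA δ a' ≡ true
    ends-in-A b e = cong₂ _∧_ (K-edge-B→A δ Δ (H⊆K b a (∧-conicalˡ _ _ edges)) bB)
                              (K-edge-B→A δ Δ (H⊆K b a' (∧-conicalʳ _ _ edges)) bB)
      where
      bB : inB δ b ≡ true
      bB = ∧-conicalˡ (inB δ b) _ e
      edges : adj H b a ∧ adj H b a' ≡ true
      edges = ∧-conicalʳ (inB δ b) _ e

  regroup : ∑[ b < n ] (𝟙 (inB δ b) * cherries H b) ≡ ∑[ a < n ] ∑[ a' < n ] (count (common-B a a') * 𝟙≢ a a')
  regroup = begin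
    ∑[ b < n ] (𝟙 (inB δ b) * cherries H b)
      ≡⟨ sum-cong-≗ distribute ⟩
    ∑[ b < n ] ∑[ a < n ] ∑[ a' < n ] term a a' b
      ≡⟨ ∑-comm (λ b a → ∑[ a' < n ] term a a' b) ⟩
    ∑[ a < n ] ∑[ b < n ] ∑[ a' < n ] term a a' b
      ≡⟨ sum-cong-≗ (λ a → ∑-comm (λ b a' → term a a' b)) ⟩
    ∑[ a < n ] ∑[ a' < n ] ∑[ b < n ] term a a' b
      ≡⟨ sum-cong-≗ (λ a → sum-cong-≗ (λ a' → sum-cong-≗ (term-common a a'))) ⟩
    ∑[ a < n ] ∑[ a' < n ] ∑[ b < n ] (𝟙 (common-B a a' b) * 𝟙≢ a a')
      ≡⟨ sum-cong-≗ (λ a → sum-cong-≗ (λ a' → *-distribʳ-sum (𝟙≢ a a') (λ b → 𝟙 (common-B a a' b)))) ⟨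
    ∑[ a < n ] ∑[ a' < n ] (count (common-B a a') * 𝟙≢ a a') ∎
    where
    open ≡-Reasoning
    pair : Fin n → Fin n → Fin n → ℕ
    pair b a a' = 𝟙 (adj H b a ∧ adj H b a') * 𝟙≢ a a'
    term : Fin n → Fin n → Fin n → ℕ
    term a a' b = 𝟙 (inB δ b) * pair b a a'
    distribute : ∀ b → 𝟙 (inB δ b) * cherries H b ≡ ∑[ a < n ] ∑[ a' < n ] term a a' b
    distribute b = trans (*-distribˡ-sum (𝟙 (inB δ b)) (λ a → ∑[ a' < n ] pair b a a'))
                         (sum-cong-≗ (λ a → *-distribˡ-sum (𝟙 (inB δ b)) (pair b a)))
    term-common : ∀ a a' b → term a a' b ≡ 𝟙 (common-B a a' b) * 𝟙≢ a a'
    term-common a a' b = begin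
      𝟙 (inB δ b) * (𝟙 (adj H b a ∧ adj H b a') * 𝟙≢ a a') ≡⟨ *-assoc (𝟙 (inB δ b)) _ _ ⟨
      𝟙 (inB δ b) * 𝟙 (adj H b a ∧ adj H b a') * 𝟙≢ a a'   ≡⟨ cong (_* 𝟙≢ a a') (𝟙-∧ (inB δ b) _) ⟨
      𝟙 (common-B a a' b) * 𝟙≢ a a'                          ∎

  cherries-upper : ∑[ b < n ] (𝟙 (inB δ b) * cherries H b) ≤ δ * δ
  cherries-upper = begin
    ∑[ b < n ] (𝟙 (inB δ b) * cherries H b)
      ≡⟨ regroup ⟩
    ∑[ a < n ] ∑[ a' < n ] (count (common-B a a') * 𝟙≢ a a')
      ≤⟨ sum-mono (λ a → sum-mono (pair-bound a)) ⟩
    ∑[ a < n ] ∑[ a' < n ] 𝟙 (inA δ a ∧ inA δ a')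
      ≡⟨ sum-cong-≗ (λ a → trans (sum-cong-≗ (λ a' → 𝟙-∧ (inA δ a) (inA δ a'))) (sym (*-distribˡ-sum (𝟙 (inA δ a)) (λ a' → 𝟙 (inA δ a'))))) ⟩
    ∑[ a < n ] (𝟙 (inA δ a) * count (inA δ))
      ≡⟨ *-distribʳ-sum (count (inA δ)) (λ a → 𝟙 (inA δ a)) ⟨
    count (inA δ) * count (inA δ)
      ≡⟨ cong₂ _*_ (count-A δ Δ) (count-A δ Δ) ⟩
    δ * δ ∎
    where open ≤-Reasoning

  min-degree-bound : ∀ d → (∀ b → d ≤ deg H b) → Δ * (d * d) ≤ δ * δ + Δ * d
  min-degree-bound d d≤deg = begin
    Δ * (d * d)
      ≡⟨ cong (_* (d * d)) (count-B δ Δ) ⟨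
    count (inB δ) * (d * d)
      ≡⟨ *-distribʳ-sum (d * d) (λ b → 𝟙 (inB δ b)) ⟩
    ∑[ b < n ] (𝟙 (inB δ b) * (d * d))
      ≤⟨ sum-mono (λ b → *-monoʳ-≤ (𝟙 (inB δ b)) (cherries-lower H b d (d≤deg b))) ⟩
    ∑[ b < n ] (𝟙 (inB δ b) * (cherries H b + d))
      ≡⟨ sum-cong-≗ (λ b → *-distribˡ-+ (𝟙 (inB δ b)) (cherries H b) d) ⟩
    ∑[ b < n ] (𝟙 (inB δ b) * cherries H b + 𝟙 (inB δ b) * d)
      ≡⟨ ∑-distrib-+ (λ b → 𝟙 (inB δ b) * cherries H b) (λ b → 𝟙 (inB δ b) * d) ⟩
    ∑[ b < n ] (𝟙 (inB δ b) * cherries H b) + ∑[ b < n ] (𝟙 (inB δ b) * d)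
      ≤⟨ +-monoˡ-≤ _ cherries-upper ⟩
    δ * δ + ∑[ b < n ] (𝟙 (inB δ b) * d)
      ≡⟨ cong (δ * δ +_) (trans (sym (*-distribʳ-sum d (λ b → 𝟙 (inB δ b)))) (cong (_* d) (count-B δ Δ))) ⟩
    δ * δ + Δ * d ∎
    where open ≤-Reasoning

square-reflects-≤ : ∀ a b → a * a ≤ b * b → a ≤ b
square-reflects-≤ a b a²≤b² with a ≤? b
... | yes a≤b = a≤b
... | no  a≰b = contradiction a²≤b² (<⇒≱ (*-mono-< (≰⇒> a≰b) (≰⇒> a≰b)))

absorb-half : ∀ X Y Z → Y + Y ≤ X → X ≤ Z + Y → X ≤ Z + Z
absorb-half X Y Z 2Y≤X X≤Z+Y = +-cancelʳ-≤ X X (Z + Z) (begin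
  X + X                 ≤⟨ +-mono-≤ X≤Z+Y X≤Z+Y ⟩
  (Z + Y) + (Z + Y)     ≡⟨ solve 2 (λ Y Z → (Z :+ Y) :+ (Z :+ Y) := (Z :+ Z) :+ (Y :+ Y)) refl Y Z ⟩
  (Z + Z) + (Y + Y)     ≤⟨ +-monoʳ-≤ (Z + Z) 2Y≤X ⟩
  (Z + Z) + X           ∎)
  where open ≤-Reasoning

-- From Δd² ≤ δ² + Δd and Δ ≤ δ²: for d ≥ 2 the linear term is at most half
-- of Δd², giving Δd² ≤ 2δ²; for d ≤ 1 the bound Δ ≤ δ² suffices.
final-bound : ∀ δ Δ d → Δ ≤ δ * δ → Δ * (d * d) ≤ δ * δ + Δ * d → d * d * Δ ≤ 2 * 2 * (δ * δ)
final-bound δ Δ zero          _     _ = z≤n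
final-bound δ Δ (suc zero)    Δ≤δ² _ = ≤-trans (≤-reflexive (+-identityʳ Δ)) (≤-trans Δ≤δ² (m≤n*m (δ * δ) 4))
final-bound δ Δ d@(suc (suc _)) _ Δd²≤ = begin
  d * d * Δ             ≡⟨ *-comm (d * d) Δ ⟩
  Δ * (d * d)           ≤⟨ absorb-half (Δ * (d * d)) (Δ * d) (δ * δ) linear≤half Δd²≤ ⟩
  δ * δ + δ * δ         ≡⟨ solve 1 (λ z → z :+ z := con 2 :* z) refl (δ * δ) ⟩
  2 * (δ * δ)           ≤⟨ *-monoˡ-≤ (δ * δ) {2} {2 * 2} (s≤s (s≤s z≤n)) ⟩
  2 * 2 * (δ * δ)       ∎
  where
  open ≤-Reasoning
  linear≤half : Δ * d + Δ * d ≤ Δ * (d * d)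
  linear≤half = begin
    Δ * d + Δ * d       ≡⟨ solve 2 (λ Δ d → Δ :* d :+ Δ :* d := Δ :* (d :* con 2)) refl Δ d ⟩
    Δ * (d * 2)         ≤⟨ *-monoʳ-≤ Δ (*-monoʳ-≤ d (s≤s (s≤s z≤n))) ⟩
    Δ * (d * d)         ∎

proposition2 : Σ ℕ λ C → 1 ≤ C × ((δ Δ : ℕ) → 1 ≤ δ → 1 ≤ Δ → Δ ≤ δ * δ → δ * δ ≤ Δ * Δ → Σ ℕ λ n → Σ (Graph n) λ G → IsMinDegree G δ × IsMaxDegree G Δ × ((H : Graph n) → IsSpanningSubgraph H G → C4Free H → (d : ℕ) → IsMinDegree H d → d * d * Δ ≤ C * C * (δ * δ)))
proposition2 = 2 , s≤s z≤n , construction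
  where
  construction : (δ Δ : ℕ) → 1 ≤ δ → 1 ≤ Δ → Δ ≤ δ * δ → δ * δ ≤ Δ * Δ → Σ ℕ λ n → Σ (Graph n) λ G → IsMinDegree G δ × IsMaxDegree G Δ × ((H : Graph n) → IsSpanningSubgraph H G → C4Free H → (d : ℕ) → IsMinDegree H d → d * d * Δ ≤ 2 * 2 * (δ * δ))
  construction δ Δ 1≤δ 1≤Δ Δ≤δ² δ²≤Δ² =
    δ + Δ , K δ Δ , K-minDegree δ Δ 1≤Δ δ≤Δ , K-maxDegree δ Δ 1≤δ δ≤Δ , bound
    where
    δ≤Δ : δ ≤ Δ
    δ≤Δ = square-reflects-≤ δ Δ δ²≤Δ²
    bound : (H : Graph (δ + Δ)) → IsSpanningSubgraph H (K δ Δ) → C4Free H → (d : ℕ) → IsMinDegree H d → d * d * Δ ≤ 2 * 2 * (δ * δ)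
    bound H H⊆K c4free d (d≤deg , _) =
      final-bound δ Δ d Δ≤δ² (CherryCount.min-degree-bound δ Δ H H⊆K c4free d d≤deg)
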